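{- Let $r,n\ge1$ be integers, $c,d\in\mathbb{Z}$, $B_{c,d}$ the $r\times r$ matrix with diagonal entries $c$ and off-diagonal entries $d$, and $\mathscr{d}_1=\gcd(c-d,n)$. A vector $\boldsymbol{x}=(x_1,\dots,x_r)^T\in(\mathbb{Z}/n\mathbb{Z})^r$ satisfies $B_{c,d}\boldsymbol{x}\equiv a\cdot\boldsymbol{1}_r\pmod n$ for some $a\in\mathbb{Z}$ if and only if for each $j\in\{2,\dots,r\}$ we have $x_j=x_1+v_j\frac{n}{\mathscr{d}_1}$ in $\mathbb{Z}/n\mathbb{Z}$ for some integer $v_j$ with $1\le v_j\le\mathscr{d}_1$.
   Context: $\boldsymbol{1}_r$ denotes the $r\times1$ column vector with all entries $1$. -}

module Defs where

open import Data.Nat as ℕ using (ℕ; zero; suc)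
open import Data.Nat.GCD using (gcd; gcd[m,n]∣n)
open import Data.Nat.Divisibility using (quotient)
open import Data.Integer using (ℤ; +_; _+_; _-_; _*_; ∣_∣)
open import Data.Integer.Divisibility using (_∣_)
open import Data.Fin using (Fin; zero; suc; _≟_)
open import Relation.Nullary.Decidable using (does)
open import Data.Bool using (if_then_else_)

_≡_[mod_] : ℤ → ℤ → ℕ → Set
a ≡ b [mod n ] = (+ n) ∣ (a - b)

∑ : ∀ {r} → (Fin r → ℤ) → ℤ
∑ {zero} f = + 0
∑ {suc r} f = f zero + ∑ (λ i → f (suc i))

B : ∀ r → ℤ → ℤ → Fin r → Fin r → ℤ
B r c d i j = if does (i ≟ j) then c else d

_·ᵥ_ : ∀ {r} → (Fin r → Fin r → ℤ) → (Fin r → ℤ) → Fin r → ℤ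
(M ·ᵥ x) i = ∑ (λ j → M i j * x j)

𝒹₁ : ℤ → ℤ → ℕ → ℕ
𝒹₁ c d n = gcd ∣ c - d ∣ n

n/𝒹₁ : ℤ → ℤ → ℕ → ℕ
n/𝒹₁ c d n = quotient (gcd[m,n]∣n ∣ c - d ∣ n)

module Submission where

-- Row i of B_{c,d} x is d Σx + (c - d) x_i, so B_{c,d} x is congruent to a constant vector
-- iff n divides every (c - d)(x_i - x_1), i.e. iff n/𝒹₁ divides every x_i - x_1
-- (because n/𝒹₁ and (c - d)/𝒹₁ are coprime).  Writing the quotient (x_i - x_1)/(n/𝒹₁)
-- as v + s 𝒹₁ with 1 ≤ v ≤ 𝒹₁ gives x_i ≡ x_1 + v n/𝒹₁ modulo n = 𝒹₁ (n/𝒹₁).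

open import Defs
open import Data.Nat using (ℕ; _≤_)
open import Data.Integer using (ℤ; +_; _+_; _*_) renaming (_≤_ to _≤ℤ_)
open import Data.Fin using (Fin; fromℕ<; toℕ)
open import Data.Product using (∃; _×_)
open import Function.Bundles using (_⇔_)

open import Data.Nat as ℕ using (suc; NonZero; ≢-nonZero; ≢-nonZero⁻¹; s≤s; z≤n)
import Data.Nat.Properties as ℕₚ
open import Data.Nat.Divisibility as ℕ∣ using (quotient) renaming (_∣_ to _∣ℕ_)
open import Data.Nat.GCD using (gcd; gcd[m,n]∣m; gcd[m,n]∣n; gcd-greatest; c*gcd[m,n]≡gcd[cm,cn]; gcd[m,n]≢0)
open import Data.Integer using (_-_; ∣_∣; +≤+; 1ℤ)
open import Data.Integer.Properties using (*-zeroʳ; *-distribˡ-+; *-comm; +-assoc; abs-*; pos-*; +-inverseʳ)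
open import Data.Integer.Divisibility using (_∣_)
import Data.Integer.Divisibility.Signed as Signed
open import Data.Integer.DivMod using (_%ℕ_; _/ℕ_; n%ℕd<d; a≡a%ℕn+[a/ℕn]*n)
open import Data.Integer.Tactic.RingSolver using (solve-∀)
open import Data.Fin using (zero; suc)
open import Data.Product using (∃₂; _,_)
open import Data.Sum using (inj₂)
open import Function.Bundles using (mk⇔; Equivalence)
open import Function.Construct.Identity using (⇔-id)
open import Function.Properties.Equivalence using (⇔-setoid)
open import Function.Related.TypeIsomorphisms using (→-cong-⇔)
open import Level using (0ℓ)
open import Relation.Binary.PropositionalEquality

∀-cong-⇔ : ∀ {A : Set} {P Q : A → Set} → (∀ a → P a ⇔ Q a) → (∀ a → P a) ⇔ (∀ a → Q a)
∀-cong-⇔ P⇔Q = mk⇔ (λ p a → Equivalence.to (P⇔Q a) (p a)) (λ q a → Equivalence.from (P⇔Q a) (q a))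

∀⇔∀1≤toℕ : ∀ {r} {P : Fin (suc r) → Set} → P zero → (∀ i → P i) ⇔ (∀ j → 1 ≤ toℕ j → P j)
∀⇔∀1≤toℕ {P = P} p₀ = mk⇔ (λ p j _ → p j) from
  where
  from : (∀ j → 1 ≤ toℕ j → P j) → ∀ i → P i
  from p zero    = p₀
  from p (suc i) = p (suc i) (s≤s z≤n)

n∣m*k⇔n/gcd[m,n]∣k : ∀ m n k .{{_ : NonZero n}} →
  n ∣ℕ m ℕ.* k ⇔ quotient (gcd[m,n]∣n m n) ∣ℕ k
n∣m*k⇔n/gcd[m,n]∣k m n k = mk⇔ to from
  where
  g = gcd m n
  q = quotient (gcd[m,n]∣n m n)
  n≡q*g : n ≡ q ℕ.* g
  n≡q*g = ℕ∣.m∣n⇒n≡quotient*m (gcd[m,n]∣n m n)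
  instance
    _ : NonZero g
    _ = ≢-nonZero (gcd[m,n]≢0 m n (inj₂ (≢-nonZero⁻¹ n)))
  to : n ∣ℕ m ℕ.* k → q ∣ℕ k
  to n∣m*k = ℕ∣.*-cancelʳ-∣ g (subst₂ _∣ℕ_ n≡q*g (sym (c*gcd[m,n]≡gcd[cm,cn] k m n)) n∣k*g)
    where
    n∣k*g : n ∣ℕ gcd (k ℕ.* m) (k ℕ.* n)
    n∣k*g = gcd-greatest (subst (n ∣ℕ_) (ℕₚ.*-comm m k) n∣m*k) (ℕ∣.n∣m*n k)
  from : q ∣ℕ k → n ∣ℕ m ℕ.* k
  from q∣k = subst₂ _∣ℕ_ (sym n≡q*g) (ℕₚ.*-comm k m)
    (ℕ∣.∣-trans (ℕ∣.*-monoˡ-∣ g q∣k) (ℕ∣.*-monoʳ-∣ k (gcd[m,n]∣m m n)))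

n∣e*y⇔n/gcd[∣e∣,n]∣y : ∀ e n y .{{_ : NonZero n}} →
  ((+ n) ∣ e * y) ⇔ ((+ quotient (gcd[m,n]∣n ∣ e ∣ n)) ∣ y)
n∣e*y⇔n/gcd[∣e∣,n]∣y e n y =
  subst (λ z → n ∣ℕ z ⇔ quotient (gcd[m,n]∣n ∣ e ∣ n) ∣ℕ ∣ y ∣) (sym (abs-* e y))
    (n∣m*k⇔n/gcd[m,n]∣k (∣ e ∣) n (∣ y ∣))

division-with-remainder-in-[1,d] : ∀ k d .{{_ : NonZero d}} →
  ∃₂ λ r s → (+ 1 ≤ℤ r) × (r ≤ℤ + d) × (k ≡ r + s * + d)
division-with-remainder-in-[1,d] k d =
  + suc t , s , +≤+ (s≤s z≤n) , +≤+ (n%ℕd<d (k - 1ℤ) d) , k≡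
  where
  t = (k - 1ℤ) %ℕ d
  s = (k - 1ℤ) /ℕ d
  k≡ : k ≡ + suc t + s * + d
  k≡ = begin
    k                       ≡⟨ shift k ⟩
    1ℤ + (k - 1ℤ)           ≡⟨ cong (_+_ 1ℤ) (a≡a%ℕn+[a/ℕn]*n (k - 1ℤ) d) ⟩
    1ℤ + (+ t + s * + d)    ≡⟨ +-assoc 1ℤ (+ t) (s * + d) ⟨
    + suc t + s * + d       ∎
    where
    open ≡-Reasoning
    shift : ∀ k → k ≡ 1ℤ + (k - 1ℤ)
    shift = solve-∀

q∣b-a⇔∃v≤g[b≡a+v*q] : ∀ {n q g} .{{_ : NonZero g}} → n ≡ q ℕ.* g → ∀ a b →
  ((+ q) ∣ (b - a)) ⇔ (∃ λ v → (+ 1 ≤ℤ v) × (v ≤ℤ + g) × (b ≡ a + v * + q [mod n ]))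
q∣b-a⇔∃v≤g[b≡a+v*q] {n} {q} {g} n≡q*g a b = mk⇔ to from
  where
  +n≡+q*+g : + n ≡ + q * + g
  +n≡+q*+g = trans (cong +_ n≡q*g) (pos-* q g)

  to : (+ q) ∣ (b - a) → ∃ λ v → (+ 1 ≤ℤ v) × (v ≤ℤ + g) × (b ≡ a + v * + q [mod n ])
  to q∣b-a with Signed.∣ᵤ⇒∣ {+ q} {b - a} q∣b-a
  ... | Signed.divides k b-a≡k*q with division-with-remainder-in-[1,d] k g
  ... | v , s , 1≤v , v≤g , k≡v+s*g = v , 1≤v , v≤g , Signed.∣⇒∣ᵤ (Signed.divides s (begin
    b - (a + v * + q)             ≡⟨ shift b a (v * + q) ⟩
    (b - a) - v * + q             ≡⟨ cong (_- v * + q) b-a≡k*q ⟩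
    k * + q - v * + q             ≡⟨ cong (λ k → k * + q - v * + q) k≡v+s*g ⟩
    (v + s * + g) * + q - v * + q ≡⟨ collect v s (+ g) (+ q) ⟩
    s * (+ q * + g)               ≡⟨ cong (s *_) +n≡+q*+g ⟨
    s * + n                       ∎))
    where
    open ≡-Reasoning
    shift : ∀ b a w → b - (a + w) ≡ (b - a) - w
    shift = solve-∀
    collect : ∀ v s g q → (v + s * g) * q - v * q ≡ s * (q * g)
    collect = solve-∀

  from : (∃ λ v → (+ 1 ≤ℤ v) × (v ≤ℤ + g) × (b ≡ a + v * + q [mod n ])) → (+ q) ∣ (b - a)
  from (v , _ , _ , n∣b-[a+v*q]) = Signed.∣⇒∣ᵤ (subst (Signed._∣_ (+ q)) (shift b a (v * + q))
    (Signed.∣m∣n⇒∣m+n q∣b-[a+v*q] (Signed.∣n⇒∣m*n v Signed.∣-refl)))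
    where
    q∣n : Signed._∣_ (+ q) (+ n)
    q∣n = Signed.divides (+ g) (trans +n≡+q*+g (*-comm (+ q) (+ g)))
    q∣b-[a+v*q] : Signed._∣_ (+ q) (b - (a + v * + q))
    q∣b-[a+v*q] = Signed.∣-trans q∣n (Signed.∣ᵤ⇒∣ {+ n} {b - (a + v * + q)} n∣b-[a+v*q])
    shift : ∀ b a w → (b - (a + w)) + w ≡ b - a
    shift = solve-∀

∃a∀i[yi≡a]⇔∀i[yi≡yi₀] : ∀ {I : Set} (i₀ : I) n (y : I → ℤ) →
  (∃ λ a → ∀ i → y i ≡ a [mod n ]) ⇔ (∀ i → y i ≡ y i₀ [mod n ])
∃a∀i[yi≡a]⇔∀i[yi≡yi₀] i₀ n y = mk⇔ to (λ y≡y₀ → y i₀ , y≡y₀)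
  where
  to : (∃ λ a → ∀ i → y i ≡ a [mod n ]) → ∀ i → y i ≡ y i₀ [mod n ]
  to (a , y≡a) i = Signed.∣⇒∣ᵤ (subst (Signed._∣_ (+ n)) (cancel (y i) (y i₀) a)
    (Signed.∣m∣n⇒∣m-n (Signed.∣ᵤ⇒∣ {+ n} {y i - a} (y≡a i)) (Signed.∣ᵤ⇒∣ {+ n} {y i₀ - a} (y≡a i₀))))
    where
    cancel : ∀ u v a → (u - a) - (v - a) ≡ u - v
    cancel = solve-∀

∑-*ˡ : ∀ {r} (k : ℤ) (f : Fin r → ℤ) → ∑ (λ j → k * f j) ≡ k * ∑ f
∑-*ˡ {ℕ.zero} k f = sym (*-zeroʳ k)
∑-*ˡ {suc r}  k f = begin
  k * f zero + ∑ (λ j → k * f (suc j)) ≡⟨ cong (_+_ (k * f zero)) (∑-*ˡ k (λ j → f (suc j))) ⟩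
  k * f zero + k * ∑ (λ j → f (suc j)) ≡⟨ *-distribˡ-+ k (f zero) _ ⟨
  k * ∑ f                              ∎
  where open ≡-Reasoning

B·ᵥ-row : ∀ {r} c d (x : Fin r → ℤ) i → (B r c d ·ᵥ x) i ≡ d * ∑ x + (c - d) * x i
B·ᵥ-row {suc r} c d x zero = begin
  c * x zero + ∑ (λ j → d * x (suc j)) ≡⟨ cong (_+_ (c * x zero)) (∑-*ˡ d (λ j → x (suc j))) ⟩
  c * x zero + d * ∑ (λ j → x (suc j)) ≡⟨ split c d (x zero) _ ⟩
  d * ∑ x + (c - d) * x zero           ∎
  where
  open ≡-Reasoning
  split : ∀ c d x₀ s → c * x₀ + d * s ≡ d * (x₀ + s) + (c - d) * x₀
  split = solve-∀
B·ᵥ-row {suc r} c d x (suc i) = begin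
  d * x zero + (B r c d ·ᵥ (λ j → x (suc j))) i
    ≡⟨ cong (_+_ (d * x zero)) (B·ᵥ-row c d (λ j → x (suc j)) i) ⟩
  d * x zero + (d * ∑ (λ j → x (suc j)) + (c - d) * x (suc i))
    ≡⟨ regroup d (x zero) _ _ ⟩
  d * ∑ x + (c - d) * x (suc i)
    ∎
  where
  open ≡-Reasoning
  regroup : ∀ d x₀ s t → d * x₀ + (d * s + t) ≡ d * (x₀ + s) + t
  regroup = solve-∀

B·ᵥ-difference : ∀ {r} c d (x : Fin r → ℤ) i k →
  (B r c d ·ᵥ x) i - (B r c d ·ᵥ x) k ≡ (c - d) * (x i - x k)
B·ᵥ-difference c d x i k = begin
  (B _ c d ·ᵥ x) i - (B _ c d ·ᵥ x) k                   ≡⟨ cong₂ _-_ (B·ᵥ-row c d x i) (B·ᵥ-row c d x k) ⟩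
  (d * ∑ x + (c - d) * x i) - (d * ∑ x + (c - d) * x k) ≡⟨ cancel (d * ∑ x) (c - d) (x i) (x k) ⟩
  (c - d) * (x i - x k)                                 ∎
  where
  open ≡-Reasoning
  cancel : ∀ s e u v → (s + e * u) - (s + e * v) ≡ e * (u - v)
  cancel = solve-∀

B·ᵥ-≡[mod]⇔n/𝒹₁∣ : ∀ {r} n .{{_ : NonZero n}} c d (x : Fin r → ℤ) i k →
  ((B r c d ·ᵥ x) i ≡ (B r c d ·ᵥ x) k [mod n ]) ⇔ ((+ n/𝒹₁ c d n) ∣ (x i - x k))
B·ᵥ-≡[mod]⇔n/𝒹₁∣ n c d x i k = subst (λ z → ((+ n) ∣ z) ⇔ ((+ n/𝒹₁ c d n) ∣ (x i - x k)))
  (sym (B·ᵥ-difference c d x i k)) (n∣e*y⇔n/gcd[∣e∣,n]∣y (c - d) n (x i - x k))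

proposition4p4 : (r n : ℕ) (1≤r : 1 ≤ r) → 1 ≤ n → (c d : ℤ) → (x : Fin r → ℤ) →
    (∃ λ (a : ℤ) → ∀ (i : Fin r) → (B r c d ·ᵥ x) i ≡ a [mod n ])
    ⇔ (∀ (j : Fin r) → 1 ≤ toℕ j →
         ∃ λ (v : ℤ) → (+ 1 ≤ℤ v) × (v ≤ℤ + 𝒹₁ c d n)
           × (x j ≡ x (fromℕ< 1≤r) + v * + n/𝒹₁ c d n [mod n ]))
proposition4p4 (suc r) n@(suc _) (s≤s z≤n) (s≤s z≤n) c d x = begin
  (∃ λ a → ∀ i → Bx i ≡ a [mod n ])
    ≈⟨ ∃a∀i[yi≡a]⇔∀i[yi≡yi₀] zero n Bx ⟩
  (∀ i → Bx i ≡ Bx zero [mod n ])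
    ≈⟨ ∀-cong-⇔ (λ i → B·ᵥ-≡[mod]⇔n/𝒹₁∣ n c d x i zero) ⟩
  (∀ i → (+ q) ∣ (x i - x zero))
    ≈⟨ ∀⇔∀1≤toℕ q∣x₀-x₀ ⟩
  (∀ j → 1 ≤ toℕ j → (+ q) ∣ (x j - x zero))
    ≈⟨ ∀-cong-⇔ (λ j → →-cong-⇔ (⇔-id _) (q∣b-a⇔∃v≤g[b≡a+v*q] n≡q*g (x zero) (x j))) ⟩
  (∀ j → 1 ≤ toℕ j → ∃ λ v → (+ 1 ≤ℤ v) × (v ≤ℤ + g) × (x j ≡ x zero + v * + q [mod n ]))
    ∎
  where
  open import Relation.Binary.Reasoning.Setoid (⇔-setoid 0ℓ)
  Bx = B (suc r) c d ·ᵥ x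
  g = 𝒹₁ c d n
  q = n/𝒹₁ c d n
  instance
    _ : NonZero g
    _ = ≢-nonZero (gcd[m,n]≢0 ∣ c - d ∣ n (inj₂ (≢-nonZero⁻¹ n)))
  n≡q*g : n ≡ q ℕ.* g
  n≡q*g = ℕ∣.m∣n⇒n≡quotient*m (gcd[m,n]∣n ∣ c - d ∣ n)
  q∣x₀-x₀ : (+ q) ∣ (x zero - x zero)
  q∣x₀-x₀ = subst ((+ q) ∣_) (sym (+-inverseʳ (x zero))) (q ℕ∣.∣0)
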